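{- Consider a Max-$k$-Coverage instance $(U,\mathcal M,k)$, let $\mathcal S=\{S_1,\dots,S_k\}$ be the output of the greedy algorithm, and let $\mathcal S^\ast=\{S_1^\ast,\dots,S_k^\ast\}$ be an optimal solution. Let $\varepsilon>0$ (possibly depending on $k$). If $\sum_{i=1}^k|S_i^\ast|>(1+\varepsilon)\mathrm{val}(\mathcal S^\ast)$, then $$\mathrm{val}(\mathcal S)\ge\Big(1-\big(1-\tfrac1k\big)^k+\tfrac{\varepsilon}{8k}\Big)\mathrm{val}(\mathcal S^\ast).$$
   Context: A Max-$k$-Coverage instance consists of a finite universe $U$, a collection $\mathcal M$ of subsets of $U$ with $|\mathcal M|\ge k$, and a positive integer $k$. For a collection $\mathcal C\subseteq\mathcal M$, $\mathrm{val}(\mathcal C)=\big|\bigcup_{T\in\mathcal C}T\big|$. An optimal solution is a collection of $k$ members of $\mathcal M$ maximizing $\mathrm{val}$. The greedy algorithm selects $k$ members of $\mathcal M$ one at a time, each time choosing a member maximizing the increase of $\mathrm{val}$ of the collection selected so far.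
   Formalization: The parameter ε ranges over the positive rationals. -}

module Defs where

open import Data.Nat as ℕ using (ℕ; zero; suc; _≤_)
open import Data.Integer using (+_)
open import Data.Rational as ℚ using (ℚ; _/_; 1ℚ)
open import Data.Fin using (Fin)
open import Data.Fin.Subset using (Subset; ⋃; ∣_∣)
open import Data.List using (List; []; _∷_; map; length)
open import Data.Nat.ListAction using (sum)
open import Data.Product using (_×_)
open import Relation.Binary.PropositionalEquality using (_≡_)
open import Data.List.Membership.Propositional using (_∉_)
open import Data.List.Relation.Unary.Unique.Propositional using (Unique)

-- The universe U is Fin n; the collection 𝓜 is an indexed family
-- 𝓜 : Fin m → Subset n (duplicates allowed). A sub-collection is
-- given by a list of indices into 𝓜.

val : ∀ {n m} → (Fin m → Subset n) → List (Fin m) → ℕ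
val 𝓜 cs = ∣ ⋃ (map 𝓜 cs) ∣

sizeSum : ∀ {n m} → (Fin m → Subset n) → List (Fin m) → ℕ
sizeSum 𝓜 cs = sum (map (λ i → ∣ 𝓜 i ∣) cs)

-- Greedy 𝓜 cs : cs (most recent choice first) is a run of the greedy
-- algorithm: each new member is not yet chosen and maximizes the
-- increase of val over all members of 𝓜.
data Greedy {n m : ℕ} (𝓜 : Fin m → Subset n) : List (Fin m) → Set where
  start : Greedy 𝓜 []
  step  : ∀ {cs} → Greedy 𝓜 cs → (j : Fin m) → j ∉ cs →
          (∀ (j′ : Fin m) → val 𝓜 (j′ ∷ cs) ≤ val 𝓜 (j ∷ cs)) →
          Greedy 𝓜 (j ∷ cs)

IsKCollection : ∀ {m} → ℕ → List (Fin m) → Set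
IsKCollection k cs = length cs ≡ k × Unique cs

IsOptimal : ∀ {n m : ℕ} → (Fin m → Subset n) → ℕ → List (Fin m) → Set
IsOptimal 𝓜 k os = IsKCollection k os ×
  (∀ (cs : List (Fin _)) → IsKCollection k cs → val 𝓜 cs ≤ val 𝓜 os)

toℚ : ℕ → ℚ
toℚ a = + a / 1

_^ℚ_ : ℚ → ℕ → ℚ
q ^ℚ zero  = 1ℚ
q ^ℚ suc e = q ℚ.* (q ^ℚ e)

module Submission where

-- Write O = val S*, g_i for the coverage after i greedy steps, and c = 1/k. Coverage is
-- submodular, so the k members of S* together add at least O - g_i to the greedy cover and
-- one of them adds at least c (O - g_i); hence O - g_{i+1} ≤ (1 - c) (O - g_i). The first
-- step does better: a best single set covers at least c Σ|S*_i| > c (1 + ε) O. Iterating,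
-- O - g_k ≤ (1 - c)^{k-1} (O - c (1 + ε) O) = (1 - c)^k O - ε c (1 - c)^{k-1} O, and
-- (1 - c)^{k-1} ≥ 1/4 by Bernoulli's inequality applied to each half of the exponent.

open import Defs
open import Data.Fin using (Fin)
open import Data.Fin.Subset using (Subset)
open import Data.List using (List; []; _∷_; map; length)
open import Relation.Binary.PropositionalEquality
  using (_≡_; refl; sym; trans; cong; subst; subst₂; module ≡-Reasoning)

module Coverage where

  open import Data.Fin.Subset using (⋃; ∣_∣; _∪_; _∩_; _⊆_; ⊥; inside; outside)
  open import Data.Vec using ([]; _∷_)
  open import Data.Nat.ListAction using (sum)

  open import Data.Nat using (ℕ; suc; _+_; _*_; _≤_; z≤n)
  open import Data.Nat.Properties
    using (+-suc; +-assoc; +-commutativeSemigroup; +-mono-≤; +-monoˡ-≤; +-monoʳ-≤; ≤-refl; ≤-trans; module ≤-Reasoning)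
  open import Data.Fin.Subset.Properties
    using (p⊆q⇒∣p∣≤∣q∣; p⊆p∪q; q⊆p∪q; x∈p∪q⁻; x∈p∩q⁺; ∣p∣≤∣p∪q∣; ∪-identityˡ)
  open import Data.Sum using ([_,_])
  open import Data.Product using (_,_)
  open import Algebra.Properties.CommutativeSemigroup +-commutativeSemigroup using (x∙yz≈y∙xz)
  open import Function using (_∘_)

  ∣p∪q∣+∣p∩q∣≡∣p∣+∣q∣ : ∀ {n} (p q : Subset n) → ∣ p ∪ q ∣ + ∣ p ∩ q ∣ ≡ ∣ p ∣ + ∣ q ∣
  ∣p∪q∣+∣p∩q∣≡∣p∣+∣q∣ []            []            = refl
  ∣p∪q∣+∣p∩q∣≡∣p∣+∣q∣ (inside  ∷ p) (inside  ∷ q) =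
    cong suc (trans (+-suc _ _) (trans (cong suc (∣p∪q∣+∣p∩q∣≡∣p∣+∣q∣ p q)) (sym (+-suc _ _))))
  ∣p∪q∣+∣p∩q∣≡∣p∣+∣q∣ (inside  ∷ p) (outside ∷ q) = cong suc (∣p∪q∣+∣p∩q∣≡∣p∣+∣q∣ p q)
  ∣p∪q∣+∣p∩q∣≡∣p∣+∣q∣ (outside ∷ p) (inside  ∷ q) =
    trans (cong suc (∣p∪q∣+∣p∩q∣≡∣p∣+∣q∣ p q)) (sym (+-suc _ _))
  ∣p∪q∣+∣p∩q∣≡∣p∣+∣q∣ (outside ∷ p) (outside ∷ q) = ∣p∪q∣+∣p∩q∣≡∣p∣+∣q∣ p q

  ∪-submodular : ∀ {n} (p q r : Subset n) → ∣ (p ∪ q) ∪ r ∣ + ∣ r ∣ ≤ ∣ p ∪ r ∣ + ∣ q ∪ r ∣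
  ∪-submodular p q r = begin
    ∣ (p ∪ q) ∪ r ∣ + ∣ r ∣                       ≤⟨ +-mono-≤ (p⊆q⇒∣p∣≤∣q∣ pq∪r⊆) (p⊆q⇒∣p∣≤∣q∣ r⊆) ⟩
    ∣ (p ∪ r) ∪ (q ∪ r) ∣ + ∣ (p ∪ r) ∩ (q ∪ r) ∣  ≡⟨ ∣p∪q∣+∣p∩q∣≡∣p∣+∣q∣ (p ∪ r) (q ∪ r) ⟩
    ∣ p ∪ r ∣ + ∣ q ∪ r ∣                         ∎
    where
    open ≤-Reasoning
    pr⊆ : p ∪ r ⊆ (p ∪ r) ∪ (q ∪ r)
    pr⊆ = p⊆p∪q (q ∪ r)
    qr⊆ : q ∪ r ⊆ (p ∪ r) ∪ (q ∪ r)
    qr⊆ = q⊆p∪q (p ∪ r) (q ∪ r)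
    pq∪r⊆ : (p ∪ q) ∪ r ⊆ (p ∪ r) ∪ (q ∪ r)
    pq∪r⊆ x∈ = [ [ (λ x∈p → pr⊆ (p⊆p∪q r x∈p)) , (λ x∈q → qr⊆ (p⊆p∪q r x∈q)) ] ∘ x∈p∪q⁻ p q
               , (λ x∈r → pr⊆ (q⊆p∪q p r x∈r)) ] (x∈p∪q⁻ (p ∪ q) r x∈)
    r⊆ : r ⊆ (p ∪ r) ∩ (q ∪ r)
    r⊆ x∈r = x∈p∩q⁺ (q⊆p∪q p r x∈r , q⊆p∪q q r x∈r)

  ⋃-∪-submodular : ∀ {A : Set} {n} (f : A → Subset n) (xs : List A) (r : Subset n) →
                   ∣ ⋃ (map f xs) ∪ r ∣ + length xs * ∣ r ∣ ≤ ∣ r ∣ + sum (map (λ x → ∣ f x ∪ r ∣) xs)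
  ⋃-∪-submodular f []       r rewrite ∪-identityˡ r = ≤-refl
  ⋃-∪-submodular f (x ∷ xs) r = begin
    ∣ (f x ∪ U) ∪ r ∣ + (∣ r ∣ + length xs * ∣ r ∣)  ≡⟨ +-assoc ∣ (f x ∪ U) ∪ r ∣ ∣ r ∣ _ ⟨
    ∣ (f x ∪ U) ∪ r ∣ + ∣ r ∣ + length xs * ∣ r ∣    ≤⟨ +-monoˡ-≤ _ (∪-submodular (f x) U r) ⟩
    ∣ f x ∪ r ∣ + ∣ U ∪ r ∣ + length xs * ∣ r ∣      ≡⟨ +-assoc ∣ f x ∪ r ∣ ∣ U ∪ r ∣ _ ⟩
    ∣ f x ∪ r ∣ + (∣ U ∪ r ∣ + length xs * ∣ r ∣)    ≤⟨ +-monoʳ-≤ ∣ f x ∪ r ∣ (⋃-∪-submodular f xs r) ⟩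
    ∣ f x ∪ r ∣ + (∣ r ∣ + Σ)                        ≡⟨ x∙yz≈y∙xz ∣ f x ∪ r ∣ ∣ r ∣ Σ ⟩
    ∣ r ∣ + (∣ f x ∪ r ∣ + Σ)                        ∎
    where
    open ≤-Reasoning
    U = ⋃ (map f xs)
    Σ = sum (map (λ x → ∣ f x ∪ r ∣) xs)

  sum-map-≤-length* : ∀ {A : Set} (f : A → ℕ) {b} (xs : List A) → (∀ x → f x ≤ b) →
                      sum (map f xs) ≤ length xs * b
  sum-map-≤-length* f []       f≤b = z≤n
  sum-map-≤-length* f (x ∷ xs) f≤b = +-mono-≤ (f≤b x) (sum-map-≤-length* f xs f≤b)

  module _ {n m} (𝓜 : Fin m → Subset n) where

    GreedyChoice : List (Fin m) → Fin m → Set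
    GreedyChoice cs j = ∀ j′ → val 𝓜 (j′ ∷ cs) ≤ val 𝓜 (j ∷ cs)

    -- The greedy inequality length os · (g_{i+1} - g_i) ≥ val os - g_i, rearranged so that
    -- no truncated subtraction occurs.
    greedy-step : ∀ os {cs j} → GreedyChoice cs j →
                  val 𝓜 os + length os * val 𝓜 cs ≤ val 𝓜 cs + length os * val 𝓜 (j ∷ cs)
    greedy-step os {cs} {j} best = begin
      val 𝓜 os + length os * ∣ C ∣                      ≤⟨ +-monoˡ-≤ _ (∣p∣≤∣p∪q∣ (⋃ (map 𝓜 os)) C) ⟩
      ∣ ⋃ (map 𝓜 os) ∪ C ∣ + length os * ∣ C ∣          ≤⟨ ⋃-∪-submodular 𝓜 os C ⟩
      ∣ C ∣ + sum (map (λ i → ∣ 𝓜 i ∪ C ∣) os)          ≤⟨ +-monoʳ-≤ ∣ C ∣ (sum-map-≤-length* _ os best) ⟩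
      ∣ C ∣ + length os * val 𝓜 (j ∷ cs)                 ∎
      where
      open ≤-Reasoning
      C = ⋃ (map 𝓜 cs)

    greedy-first-step : ∀ os {j} → GreedyChoice [] j → sizeSum 𝓜 os ≤ length os * val 𝓜 (j ∷ [])
    greedy-first-step os best = sum-map-≤-length* _ os (λ i → ≤-trans (∣p∣≤∣p∪q∣ (𝓜 i) ⊥) (best i))

module Estimates where

  open import Data.Nat as ℕ using (ℕ; zero; suc; NonZero; ⌊_/2⌋; ⌈_/2⌉)
  import Data.Nat.Properties as ℕ
  open import Data.Integer as ℤ using (+_)
  import Data.Integer.Properties as ℤ
  open import Data.Nat.Coprimality using (1-coprimeTo) renaming (sym to coprime-sym)
  open import Data.Rational using (ℚ; mkℚ; _/_; 1ℚ; 0ℚ; _+_; _*_; _-_; -_; _≤_; *≤*; nonNegative)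
  open import Data.Rational.Properties
    using ( normalize-coprime; normalize-nonNeg; nonNegative⁻¹; nonNeg*nonNeg⇒nonNeg; *-inverseˡ
          ; +-mono-≤; +-monoˡ-≤; +-monoʳ-≤; *-monoˡ-≤-nonNeg; +-inverseʳ
          ; +-identityʳ; *-identityˡ; *-identityʳ; *-assoc; ≤-refl; module ≤-Reasoning)
  open import Data.Rational.Solver using (module +-*-Solver)
  open +-*-Solver using (solve; _:+_; _:-_; _:*_; _:=_; con)
  open Coverage using (greedy-step; greedy-first-step)

  toℚ≡mkℚ : ∀ a → toℚ a ≡ mkℚ (+ a) 0 (coprime-sym (1-coprimeTo a))
  toℚ≡mkℚ a = normalize-coprime (coprime-sym (1-coprimeTo a))

  toℚ-+ : ∀ a b → toℚ (a ℕ.+ b) ≡ toℚ a + toℚ b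
  toℚ-+ a b rewrite toℚ≡mkℚ a | toℚ≡mkℚ b | ℤ.*-identityʳ (+ a) | ℤ.*-identityʳ (+ b) = refl

  toℚ-* : ∀ a b → toℚ (a ℕ.* b) ≡ toℚ a * toℚ b
  toℚ-* a b rewrite toℚ≡mkℚ a | toℚ≡mkℚ b | sym (ℤ.pos-* a b) = refl

  toℚ-mono-≤ : ∀ {a b} → a ℕ.≤ b → toℚ a ≤ toℚ b
  toℚ-mono-≤ {a} {b} a≤b rewrite toℚ≡mkℚ a | toℚ≡mkℚ b =
    *≤* (subst₂ ℤ._≤_ (sym (ℤ.*-identityʳ (+ a))) (sym (ℤ.*-identityʳ (+ b))) (ℤ.+≤+ a≤b))

  0≤toℚ : ∀ a → 0ℚ ≤ toℚ a
  0≤toℚ a = toℚ-mono-≤ {0} {a} ℕ.z≤n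

  1/n*n≡1 : ∀ n .{{_ : NonZero n}} → + 1 / n * toℚ n ≡ 1ℚ
  1/n*n≡1 (suc n) rewrite toℚ≡mkℚ (suc n) | normalize-coprime {1} {n} (1-coprimeTo (suc n)) =
    *-inverseˡ (mkℚ (+ suc n) 0 (coprime-sym (1-coprimeTo (suc n))))

  0≤1/n : ∀ n .{{_ : NonZero n}} → 0ℚ ≤ + 1 / n
  0≤1/n n = nonNegative⁻¹ (+ 1 / n) {{normalize-nonNeg 1 n}}

  1/n≤1 : ∀ n .{{_ : NonZero n}} → + 1 / n ≤ 1ℚ
  1/n≤1 n = begin
    + 1 / n          ≡⟨ *-identityʳ (+ 1 / n) ⟨
    + 1 / n * 1ℚ     ≤⟨ *-monoˡ-≤-nonNeg (+ 1 / n) {{nonNegative (0≤1/n n)}} (toℚ-mono-≤ (ℕ.>-nonZero⁻¹ n)) ⟩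
    + 1 / n * toℚ n  ≡⟨ 1/n*n≡1 n ⟩
    1ℚ               ∎
    where open ≤-Reasoning

  p≤q⇒0≤q-p : ∀ {p q} → p ≤ q → 0ℚ ≤ q - p
  p≤q⇒0≤q-p {p} {q} p≤q = subst (_≤ q - p) (+-inverseʳ p) (+-monoˡ-≤ (- p) p≤q)

  -- Inequalities are proved by writing q - p as a combination of quantities already known
  -- to be nonnegative; the ring solver checks the identity.
  ≤-by-difference : ∀ {p q x} → 0ℚ ≤ x → x ≡ q - p → p ≤ q
  ≤-by-difference {p} {q} 0≤x refl = subst₂ _≤_ (+-identityʳ p) p+[q-p]≡q (+-monoʳ-≤ p 0≤x)
    where
    p+[q-p]≡q : p + (q - p) ≡ q
    p+[q-p]≡q = solve 2 (λ p q → p :+ (q :- p) := q) refl p q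

  0≤+ : ∀ {p q} → 0ℚ ≤ p → 0ℚ ≤ q → 0ℚ ≤ p + q
  0≤+ = +-mono-≤

  0≤* : ∀ {p q} → 0ℚ ≤ p → 0ℚ ≤ q → 0ℚ ≤ p * q
  0≤* {p} {q} 0≤p 0≤q =
    nonNegative⁻¹ (p * q) {{nonNeg*nonNeg⇒nonNeg p {{nonNegative 0≤p}} q {{nonNegative 0≤q}}}}

  toℚ-+-* : ∀ a k b → toℚ (a ℕ.+ k ℕ.* b) ≡ toℚ a + toℚ k * toℚ b
  toℚ-+-* a k b = trans (toℚ-+ a (k ℕ.* b)) (cong (λ x → toℚ a + x) (toℚ-* k b))

  gap-contracts : ∀ {o g g′ k} .{{_ : NonZero k}} → o ℕ.+ k ℕ.* g ℕ.≤ g ℕ.+ k ℕ.* g′ →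
                  toℚ o - toℚ g′ ≤ (1ℚ - + 1 / k) * (toℚ o - toℚ g)
  gap-contracts {o} {g} {g′} {k} improves =
    ≤-by-difference (0≤* (0≤1/n k) (p≤q⇒0≤q-p improves′)) certificate
    where
    c = + 1 / k
    K = toℚ k
    O = toℚ o
    G = toℚ g
    G′ = toℚ g′
    improves′ : O + K * G ≤ G + K * G′
    improves′ = subst₂ _≤_ (toℚ-+-* o k g) (toℚ-+-* g k g′) (toℚ-mono-≤ improves)
    certificate : c * ((G + K * G′) - (O + K * G)) ≡ (1ℚ - c) * (O - G) - (O - G′)
    certificate = begin
      c * ((G + K * G′) - (O + K * G))         ≡⟨ solve 5 (λ c K O G G′ → c :* ((G :+ K :* G′) :- (O :+ K :* G))
                                                     := (c :* K) :* G′ :- (c :* K) :* G :+ c :* G :- c :* O) refl c K O G G′ ⟩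
      (c * K) * G′ - (c * K) * G + c * G - c * O ≡⟨ cong (λ u → u * G′ - u * G + c * G - c * O) (1/n*n≡1 k) ⟩
      1ℚ * G′ - 1ℚ * G + c * G - c * O          ≡⟨ solve 4 (λ c O G G′ → con 1ℚ :* G′ :- con 1ℚ :* G :+ c :* G :- c :* O
                                                     := (con 1ℚ :- c) :* (O :- G) :- (O :- G′)) refl c O G G′ ⟩
      (1ℚ - c) * (O - G) - (O - G′)             ∎
      where open ≡-Reasoning

  gap-first : ∀ {o s g k} .{{_ : NonZero k}} → s ℕ.≤ k ℕ.* g → toℚ o - toℚ g ≤ toℚ o - + 1 / k * toℚ s
  gap-first {o} {s} {g} {k} s≤kg =
    ≤-by-difference (0≤* (0≤1/n k) (p≤q⇒0≤q-p s≤kg′)) certificate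
    where
    c = + 1 / k
    K = toℚ k
    O = toℚ o
    S = toℚ s
    G = toℚ g
    s≤kg′ : S ≤ K * G
    s≤kg′ = subst (S ≤_) (toℚ-* k g) (toℚ-mono-≤ s≤kg)
    certificate : c * (K * G - S) ≡ (O - c * S) - (O - G)
    certificate = begin
      c * (K * G - S)          ≡⟨ solve 4 (λ c K S G → c :* (K :* G :- S) := (c :* K) :* G :- c :* S) refl c K S G ⟩
      (c * K) * G - c * S      ≡⟨ cong (λ u → u * G - c * S) (1/n*n≡1 k) ⟩
      1ℚ * G - c * S           ≡⟨ solve 4 (λ c O S G → con 1ℚ :* G :- c :* S := (O :- c :* S) :- (O :- G)) refl c O S G ⟩
      (O - c * S) - (O - G)    ∎
      where open ≡-Reasoning

  greedy-gap : ∀ {n m} (𝓜 : Fin m → Subset n) os k .{{_ : NonZero k}} → length os ≡ k →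
               ∀ {cs} t → Greedy 𝓜 cs → length cs ≡ suc t →
               toℚ (val 𝓜 os) - toℚ (val 𝓜 cs)
                 ≤ (1ℚ - + 1 / k) ^ℚ t * (toℚ (val 𝓜 os) - + 1 / k * toℚ (sizeSum 𝓜 os))
  greedy-gap 𝓜 os _ refl zero (step start j _ best) refl =
    subst (toℚ (val 𝓜 os) - toℚ (val 𝓜 (j ∷ [])) ≤_) (sym (*-identityˡ _))
      (gap-first {o = val 𝓜 os} (greedy-first-step 𝓜 os best))
  greedy-gap 𝓜 os _ refl zero (step (step _ _ _ _) _ _ _) ()
  greedy-gap 𝓜 os _ refl (suc t) (step {cs} greedy j _ best) |cs|≡2+t = begin
    O - toℚ (val 𝓜 (j ∷ cs))  ≤⟨ gap-contracts (greedy-step 𝓜 os {cs} best) ⟩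
    r * (O - toℚ (val 𝓜 cs))  ≤⟨ *-monoˡ-≤-nonNeg r {{nonNegative (p≤q⇒0≤q-p (1/n≤1 (length os)))}}
                                    (greedy-gap 𝓜 os _ refl t greedy (ℕ.suc-injective |cs|≡2+t)) ⟩
    r * (r ^ℚ t * B)          ≡⟨ *-assoc r (r ^ℚ t) B ⟨
    r * r ^ℚ t * B            ∎
    where
    open ≤-Reasoning
    O = toℚ (val 𝓜 os)
    r = 1ℚ - + 1 / length os
    B = O - + 1 / length os * toℚ (sizeSum 𝓜 os)

  bernoulli : ∀ {c} → 0ℚ ≤ c → c ≤ 1ℚ → ∀ a → 1ℚ - toℚ a * c ≤ (1ℚ - c) ^ℚ a
  bernoulli {c} 0≤c c≤1 zero =
    ≤-by-difference ≤-refl (solve 1 (λ c → con 0ℚ := con 1ℚ :- (con 1ℚ :- con 0ℚ :* c)) refl c)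
  bernoulli {c} 0≤c c≤1 (suc a) =
    ≤-by-difference (0≤+ (0≤* (p≤q⇒0≤q-p c≤1) (p≤q⇒0≤q-p (bernoulli 0≤c c≤1 a))) (0≤* (0≤* (0≤toℚ a) 0≤c) 0≤c))
      (trans (solve 3 (λ c A P → (con 1ℚ :- c) :* (P :- (con 1ℚ :- A :* c)) :+ A :* c :* c
                               := (con 1ℚ :- c) :* P :- (con 1ℚ :- (con 1ℚ :+ A) :* c)) refl c A P)
             (cong (λ x → (1ℚ - c) * P - (1ℚ - x * c)) (sym (toℚ-+ 1 a))))
    where
    A = toℚ a
    P = (1ℚ - c) ^ℚ a

  0≤^ℚ : ∀ {q} → 0ℚ ≤ q → ∀ a → 0ℚ ≤ q ^ℚ a
  0≤^ℚ 0≤q zero    = 0≤toℚ 1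
  0≤^ℚ 0≤q (suc a) = 0≤* 0≤q (0≤^ℚ 0≤q a)

  ^ℚ-distribˡ-+-* : ∀ q a b → q ^ℚ (a ℕ.+ b) ≡ q ^ℚ a * q ^ℚ b
  ^ℚ-distribˡ-+-* q zero    b = sym (*-identityˡ _)
  ^ℚ-distribˡ-+-* q (suc a) b = trans (cong (q *_) (^ℚ-distribˡ-+-* q a b)) (sym (*-assoc q _ _))

  1≤2*[1-1/k]^a : ∀ k .{{_ : NonZero k}} a → a ℕ.+ a ℕ.≤ k → 1ℚ ≤ toℚ 2 * (1ℚ - + 1 / k) ^ℚ a
  1≤2*[1-1/k]^a k a a+a≤k =
    ≤-by-difference (0≤+ (0≤* (0≤toℚ 2) (p≤q⇒0≤q-p (bernoulli (0≤1/n k) (1/n≤1 k) a)))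
                         (0≤* (0≤1/n k) (p≤q⇒0≤q-p (toℚ-mono-≤ a+a≤k))))
      (begin
        toℚ 2 * (P - (1ℚ - A * c)) + c * (K - toℚ (a ℕ.+ a)) ≡⟨ cong (λ x → toℚ 2 * (P - (1ℚ - A * c)) + c * (K - x)) (toℚ-+ a a) ⟩
        toℚ 2 * (P - (1ℚ - A * c)) + c * (K - (A + A))       ≡⟨ solve 4 (λ c K A P → con (toℚ 2) :* (P :- (con 1ℚ :- A :* c)) :+ c :* (K :- (A :+ A))
                                                                   := con (toℚ 2) :* P :- con (toℚ 2) :+ c :* K) refl c K A P ⟩
        toℚ 2 * P - toℚ 2 + c * K                            ≡⟨ cong (λ x → toℚ 2 * P - toℚ 2 + x) (1/n*n≡1 k) ⟩
        toℚ 2 * P - toℚ 2 + 1ℚ                               ≡⟨ solve 1 (λ P → con (toℚ 2) :* P :- con (toℚ 2) :+ con 1ℚ := con (toℚ 2) :* P :- con 1ℚ) refl P ⟩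
        toℚ 2 * P - 1ℚ                                       ∎)
    where
    open ≡-Reasoning
    c = + 1 / k
    K = toℚ k
    A = toℚ a
    P = (1ℚ - c) ^ℚ a

  1≤2p⇒1≤2q⇒1≤4pq : ∀ {p q} → 1ℚ ≤ toℚ 2 * p → 1ℚ ≤ toℚ 2 * q → 1ℚ ≤ toℚ 4 * (p * q)
  1≤2p⇒1≤2q⇒1≤4pq {p} {q} 1≤2p 1≤2q =
    ≤-by-difference (0≤+ (0≤+ (0≤* (p≤q⇒0≤q-p 1≤2p) (p≤q⇒0≤q-p 1≤2q)) (p≤q⇒0≤q-p 1≤2p)) (p≤q⇒0≤q-p 1≤2q))
      (solve 2 (λ p q → let x = con (toℚ 2) :* p :- con 1ℚ ; y = con (toℚ 2) :* q :- con 1ℚ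
                        in x :* y :+ x :+ y := con (toℚ 4) :* (p :* q) :- con 1ℚ) refl p q)

  1≤4*[1-1/k]^[k-1] : ∀ t → 1ℚ ≤ toℚ 4 * (1ℚ - + 1 / suc t) ^ℚ t
  1≤4*[1-1/k]^[k-1] t =
    subst (λ s → 1ℚ ≤ toℚ 4 * r ^ℚ s) (ℕ.⌊n/2⌋+⌈n/2⌉≡n t)
      (subst (λ x → 1ℚ ≤ toℚ 4 * x) (sym (^ℚ-distribˡ-+-* r a b))
        (1≤2p⇒1≤2q⇒1≤4pq {r ^ℚ a} {r ^ℚ b} (1≤2*[1-1/k]^a (suc t) a a+a≤1+t) (1≤2*[1-1/k]^a (suc t) b b+b≤1+t)))
    where
    r = 1ℚ - + 1 / suc t
    a = ⌊ t /2⌋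
    b = ⌈ t /2⌉
    a+a≤1+t : a ℕ.+ a ℕ.≤ suc t
    a+a≤1+t = ℕ.≤-trans (ℕ.+-monoʳ-≤ a (ℕ.⌊n/2⌋≤⌈n/2⌉ t)) (ℕ.m≤n⇒m≤1+n (ℕ.≤-reflexive (ℕ.⌊n/2⌋+⌈n/2⌉≡n t)))
    b+b≤1+t : b ℕ.+ b ℕ.≤ suc t
    b+b≤1+t = subst (b ℕ.+ b ℕ.≤_) (cong suc (ℕ.⌊n/2⌋+⌈n/2⌉≡n t)) (ℕ.+-monoˡ-≤ b (ℕ.⌊n/2⌋-mono (ℕ.n≤1+n (suc t))))

  1/n≡8*1/[8n] : ∀ n .{{_ : NonZero n}} → + 1 / n ≡ toℚ 8 * _/_ (+ 1) (8 ℕ.* n) {{ℕ.m*n≢0 8 n}}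
  1/n≡8*1/[8n] n = begin
    c                                  ≡⟨ *-identityʳ c ⟨
    c * 1ℚ                             ≡⟨ cong (c *_) (1/n*n≡1 (8 ℕ.* n) {{ℕ.m*n≢0 8 n}}) ⟨
    c * (e * toℚ (8 ℕ.* n))            ≡⟨ cong (λ x → c * (e * x)) (toℚ-* 8 n) ⟩
    c * (e * (toℚ 8 * K))              ≡⟨ solve 3 (λ c e K → c :* (e :* (con (toℚ 8) :* K)) := con (toℚ 8) :* e :* (c :* K)) refl c e K ⟩
    toℚ 8 * e * (c * K)                ≡⟨ cong (toℚ 8 * e *_) (1/n*n≡1 n) ⟩
    toℚ 8 * e * 1ℚ                     ≡⟨ *-identityʳ (toℚ 8 * e) ⟩
    toℚ 8 * e                          ∎
    where
    open ≡-Reasoning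
    c = + 1 / n
    e = _/_ (+ 1) (8 ℕ.* n) {{ℕ.m*n≢0 8 n}}
    K = toℚ n

  1/[8k]≤1/k*[1-1/k]^[k-1] : ∀ t → + 1 / (8 ℕ.* suc t) ≤ + 1 / suc t * (1ℚ - + 1 / suc t) ^ℚ t
  1/[8k]≤1/k*[1-1/k]^[k-1] t =
    ≤-by-difference (0≤* (0≤1/n (8 ℕ.* suc t)) (0≤+ (0≤* (0≤toℚ 2) (p≤q⇒0≤q-p (1≤4*[1-1/k]^[k-1] t))) (0≤toℚ 1)))
      (trans (solve 2 (λ e P → e :* (con (toℚ 2) :* (con (toℚ 4) :* P :- con 1ℚ) :+ con 1ℚ)
                             := con (toℚ 8) :* e :* P :- e) refl e P)
             (cong (λ c → c * P - e) (sym (1/n≡8*1/[8n] (suc t)))))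
    where
    e = + 1 / (8 ℕ.* suc t)
    P = (1ℚ - + 1 / suc t) ^ℚ t

  approximation-from-gap : ∀ {c e ε P O G Σ} → 0ℚ ≤ ε → 0ℚ ≤ O → 0ℚ ≤ c → 0ℚ ≤ P → e ≤ c * P →
                           (1ℚ + ε) * O ≤ Σ → O - G ≤ P * (O - c * Σ) →
                           (1ℚ - (1ℚ - c) * P + ε * e) * O ≤ G
  approximation-from-gap {c} {e} {ε} {P} {O} {G} {Σ} 0≤ε 0≤O 0≤c 0≤P e≤cP Σ-large gap =
    ≤-by-difference
      (0≤+ (0≤+ (p≤q⇒0≤q-p gap) (0≤* (0≤* 0≤P 0≤c) (p≤q⇒0≤q-p Σ-large))) (0≤* (0≤* 0≤ε 0≤O) (p≤q⇒0≤q-p e≤cP)))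
      (solve 7 (λ c e ε P O G Σ →
                  (P :* (O :- c :* Σ) :- (O :- G)) :+ P :* c :* (Σ :- (con 1ℚ :+ ε) :* O) :+ ε :* O :* (c :* P :- e)
                  := G :- (con 1ℚ :- (con 1ℚ :- c) :* P :+ ε :* e) :* O) refl c e ε P O G Σ)

open import Data.Nat as ℕ using (ℕ; _≤_; NonZero; _*_; suc)
open import Data.Integer using (+_)
open import Data.Rational as ℚ using (ℚ; _/_; 1ℚ; 0ℚ)
open import Data.Rational.Properties using (<⇒≤)
open import Data.Nat.Properties using (m*n≢0)
open import Data.Product using (_,_)
open Estimates

lemma5 : (n m : ℕ) (𝓜 : Fin m → Subset n) (k : ℕ) .{{_ : NonZero k}} → k ≤ m →
         (S S* : List (Fin m)) → Greedy 𝓜 S → length S ≡ k → IsOptimal 𝓜 k S* →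
         (ε : ℚ) → 0ℚ ℚ.< ε →
         (1ℚ ℚ.+ ε) ℚ.* toℚ (val 𝓜 S*) ℚ.< toℚ (sizeSum 𝓜 S*) →
         (1ℚ ℚ.- ((1ℚ ℚ.- (+ 1 / k)) ^ℚ k) ℚ.+ ε ℚ.* (_/_ (+ 1) (8 * k) {{m*n≢0 8 k}})) ℚ.* toℚ (val 𝓜 S*)
           ℚ.≤ toℚ (val 𝓜 S)
lemma5 n m 𝓜 k@(suc t) _ S S* greedy |S|≡k ((|S*|≡k , _) , _) ε 0<ε Σ-large =
  approximation-from-gap (<⇒≤ 0<ε) (0≤toℚ (val 𝓜 S*)) (0≤1/n k) (0≤^ℚ (p≤q⇒0≤q-p (1/n≤1 k)) t)
    (1/[8k]≤1/k*[1-1/k]^[k-1] t) (<⇒≤ Σ-large) (greedy-gap 𝓜 S* k |S*|≡k t greedy |S|≡k)
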